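{- Let $T_l$ and $T_r$ be AVL trees and $k$ a key, and run the AVL join algorithm $\mathrm{join}(T_l,k,T_r)$ described in the context. Then the algorithm works correctly, i.e. it returns a binary tree whose in-order sequence is the in-order sequence of $T_l$, followed by $k$, followed by the in-order sequence of $T_r$; it runs with $O(|h(T_l)-h(T_r)|)$ work; and the returned tree satisfies the AVL invariant and has height at most $1+\max(h(T_l),h(T_r))$.
   Context: A binary tree is either the empty tree $\mathrm{Leaf}$ or a node $\mathrm{Node}(L,k,R)$ consisting of a left binary tree $L$, a key $k$ and a right binary tree $R$. The height is $h(\mathrm{Leaf})=0$ and $h(\mathrm{Node}(L,k,R))=1+\max(h(L),h(R))$. $\mathrm{expose}(\mathrm{Node}(L,k,R))=(L,k,R)$. The in-order sequence of $\mathrm{Node}(L,k,R)$ is the in-order sequence of $L$, then $k$, then that of $R$. Rotations: $\mathrm{rotateLeft}(\mathrm{Node}(A,x,\mathrm{Node}(B,y,C)))=\mathrm{Node}(\mathrm{Node}(A,x,B),y,C)$ and $\mathrm{rotateRight}$ is its inverse. An AVL tree is a binary tree in which, at every node $\mathrm{Node}(L,k,R)$, $|h(L)-h(R)|\le 1$. Every node stores its height, so $h(\cdot)$ costs $O(1)$; expose, node creation and rotations cost $O(1)$ work. AVL join algorithm. $\mathrm{joinRight}(T_l,k,T_r)$: let $(l,k',c)=\mathrm{expose}(T_l)$. If $h(c)\le h(T_r)+1$: let $T'=\mathrm{Node}(c,k,T_r)$; if $h(T')\le h(l)+1$ return $\mathrm{Node}(l,k',T')$, else return $\mathrm{rotateLeft}(\mathrm{Node}(l,k',\mathrm{rotateRight}(T')))$.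 Otherwise let $T'=\mathrm{joinRight}(c,k,T_r)$ and $T''=\mathrm{Node}(l,k',T')$; if $h(T')\le h(l)+1$ return $T''$, else return $\mathrm{rotateLeft}(T'')$. $\mathrm{joinLeft}$ is the mirror image of $\mathrm{joinRight}$. $\mathrm{join}(T_l,k,T_r)$: if $h(T_l)>h(T_r)+1$ return $\mathrm{joinRight}(T_l,k,T_r)$; else if $h(T_r)>h(T_l)+1$ return $\mathrm{joinLeft}(T_l,k,T_r)$; else return $\mathrm{Node}(T_l,k,T_r)$. -}

module Defs where

open import Data.Nat using (ℕ; zero; suc; _+_; _≤_; _⊔_; _≤ᵇ_; _<ᵇ_)
open import Data.Bool using (Bool; true; false; if_then_else_)
open import Data.List using (List; []; _∷_; _++_)
open import Data.Product using (_×_; _,_)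

data Tree (A : Set) : Set where
  Leaf : Tree A
  Node : Tree A → A → Tree A → Tree A

module _ {A : Set} where

  h : Tree A → ℕ
  h Leaf         = 0
  h (Node l _ r) = suc (h l ⊔ h r)

  inorder : Tree A → List A
  inorder Leaf         = []
  inorder (Node l k r) = inorder l ++ k ∷ inorder r

  -- rotations (identity on trees of the wrong shape; never used on those)
  rotateLeft : Tree A → Tree A
  rotateLeft (Node a x (Node b y c)) = Node (Node a x b) y c
  rotateLeft t = t

  rotateRight : Tree A → Tree A
  rotateRight (Node (Node a x b) y c) = Node a x (Node b y c)
  rotateRight t = t

  data AVL : Tree A → Set where
    avl-leaf : AVL Leaf
    avl-node : ∀ {l r} (k : A) → AVL l → AVL r →
               h l ≤ suc (h r) → h r ≤ suc (h l) → AVL (Node l k r)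

  -- Each invocation of joinRight / joinLeft / join performs O(1) work
  -- (height lookups, expose, node creation, at most two rotations),
  -- so we charge 1 unit per invocation; the second component is the total work.
  joinRight : Tree A → A → Tree A → Tree A × ℕ
  joinRight Leaf k tr = Node Leaf k tr , 1   -- unreachable from join
  joinRight (Node l k' c) k tr =
    if h c ≤ᵇ suc (h tr)
    then (let T' = Node c k tr in
          if h T' ≤ᵇ suc (h l)
          then Node l k' T' , 1
          else rotateLeft (Node l k' (rotateRight T')) , 1)
    else go (joinRight c k tr)
    where
    go : Tree A × ℕ → Tree A × ℕ
    go (T' , w) = (if h T' ≤ᵇ suc (h l)
                   then Node l k' T'
                   else rotateLeft (Node l k' T')) , suc w

  joinLeft : Tree A → A → Tree A → Tree A × ℕ
  joinLeft tl k Leaf = Node tl k Leaf , 1   -- unreachable from join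
  joinLeft tl k (Node c k' r) =
    if h c ≤ᵇ suc (h tl)
    then (let T' = Node tl k c in
          if h T' ≤ᵇ suc (h r)
          then Node T' k' r , 1
          else rotateRight (Node (rotateLeft T') k' r) , 1)
    else go (joinLeft tl k c)
    where
    go : Tree A × ℕ → Tree A × ℕ
    go (T' , w) = (if h T' ≤ᵇ suc (h r)
                   then Node T' k' r
                   else rotateRight (Node T' k' r)) , suc w

  join : Tree A → A → Tree A → Tree A × ℕ
  join tl k tr =
    if suc (h tr) <ᵇ h tl then joinRight tl k tr
    else if suc (h tl) <ᵇ h tr then joinLeft tl k tr
    else (Node tl k tr , 1)

-- joinRight walks down the right spine of the taller tree tl until it reaches a subtree c
-- at most one taller than tr and replaces it by Node c k tr.  By induction along the
-- spine, the tree returned to each level is AVL and either has the height of the subtree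
-- it replaces or is one taller; in the latter case it is right-high with a left child one
-- lower than the replaced subtree, which is exactly the shape a single left rotation at the
-- parent repairs (at the bottom a double rotation does the same job).  Rotations preserve
-- the in-order sequence, and each level of the spine costs one unit of work, so the work
-- is at most 1 + h tl - h tr.  joinLeft is the mirror image of joinRight, and mirroring
-- reverses in-order sequences while preserving heights and balance, so everything about
-- joinLeft is transported from joinRight.

module Submission where

open import Defs
open import Data.Bool using (true; false; if_then_else_)
open import Data.List using (List; _∷_; _++_; reverse; _∷ʳ_)
open import Data.List.Properties
  using (++-assoc; reverse-++; unfold-reverse; ∷ʳ-++; reverse-injective)
open import Data.Nat
  using (ℕ; zero; suc; _+_; _*_; _∸_; _≤_; _<_; _⊔_; ∣_-_∣; _≤ᵇ_; _<ᵇ_; z≤n; s≤s)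
open import Data.Nat.Properties
open import Data.Product using (Σ; _×_; _,_; proj₁; proj₂; map₁)
open import Function using (_∘_)
open import Relation.Binary using (tri<; tri≈; tri>)
open import Relation.Binary.PropositionalEquality
  using (_≡_; refl; sym; trans; cong; cong₂; subst; subst₂; module ≡-Reasoning)
open import Relation.Nullary.Reflects using (ofʸ; ofⁿ; det)

≤ᵇ-true : ∀ {m n} → m ≤ n → (m ≤ᵇ n) ≡ true
≤ᵇ-true {m} {n} m≤n = det (≤ᵇ-reflects-≤ m n) (ofʸ m≤n)

≤ᵇ-false : ∀ {m n} → n < m → (m ≤ᵇ n) ≡ false
≤ᵇ-false {m} {n} n<m = det (≤ᵇ-reflects-≤ m n) (ofⁿ (<⇒≱ n<m))

reverse-++-∷ : ∀ {A : Set} (xs : List A) (x : A) (ys : List A) →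
               reverse (xs ++ x ∷ ys) ≡ reverse ys ++ x ∷ reverse xs
reverse-++-∷ xs x ys = begin
  reverse (xs ++ x ∷ ys)           ≡⟨ reverse-++ xs (x ∷ ys) ⟩
  reverse (x ∷ ys) ++ reverse xs   ≡⟨ cong (_++ reverse xs) (unfold-reverse x ys) ⟩
  reverse ys ∷ʳ x ++ reverse xs    ≡⟨ ∷ʳ-++ (reverse ys) x (reverse xs) ⟩
  reverse ys ++ x ∷ reverse xs     ∎
  where open ≡-Reasoning

data Balance : ℕ → ℕ → Set where
  ∼0 : ∀ {n} → Balance n n
  ∼- : ∀ {n} → Balance (suc n) n
  ∼+ : ∀ {n} → Balance n (suc n)

balance : ∀ {a b} → a ≤ suc b → b ≤ suc a → Balance a b
balance {a} {b} a≤ b≤ with <-cmp a b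
... | tri< a<b _ _ = subst (Balance a) (≤-antisym a<b b≤) ∼+
... | tri≈ _ a≡b _ = subst (Balance a) a≡b ∼0
... | tri> _ _ b<a = subst (λ c → Balance c b) (≤-antisym b<a a≤) ∼-

module _ {A : Set} where

  balanceRight : Tree A → A → Tree A → Tree A
  balanceRight l k r = if h r ≤ᵇ suc (h l) then Node l k r else rotateLeft (Node l k r)

  balanceLeft : Tree A → A → Tree A → Tree A
  balanceLeft l k r = if h l ≤ᵇ suc (h r) then Node l k r else rotateRight (Node l k r)

  inorder-rotateLeft : (t : Tree A) → inorder (rotateLeft t) ≡ inorder t
  inorder-rotateLeft (Node a x (Node b y c)) = ++-assoc (inorder a) (x ∷ inorder b) (y ∷ inorder c)
  inorder-rotateLeft (Node a x Leaf)         = refl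
  inorder-rotateLeft Leaf                    = refl

  inorder-rotateRight : (t : Tree A) → inorder (rotateRight t) ≡ inorder t
  inorder-rotateRight (Node (Node a x b) y c) =
    sym (++-assoc (inorder a) (x ∷ inorder b) (y ∷ inorder c))
  inorder-rotateRight (Node Leaf y c)         = refl
  inorder-rotateRight Leaf                    = refl

  inorder-balanceRight : (l : Tree A) (k : A) (r : Tree A) →
                         inorder (balanceRight l k r) ≡ inorder (Node l k r)
  inorder-balanceRight l k r with h r ≤ᵇ suc (h l)
  ... | true  = refl
  ... | false = inorder-rotateLeft (Node l k r)

  inorder-joinRight : (tl : Tree A) (k : A) (tr : Tree A) →
                      inorder (proj₁ (joinRight tl k tr)) ≡ inorder tl ++ k ∷ inorder tr
  inorder-joinRight Leaf k tr = refl
  inorder-joinRight (Node l k′ c) k tr with h c ≤ᵇ suc (h tr)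
  ... | true with h (Node c k tr) ≤ᵇ suc (h l)
  ...   | true  = sym (++-assoc (inorder l) (k′ ∷ inorder c) (k ∷ inorder tr))
  ...   | false = begin
    inorder (rotateLeft (Node l k′ (rotateRight (Node c k tr))))
      ≡⟨ inorder-rotateLeft (Node l k′ (rotateRight (Node c k tr))) ⟩
    inorder l ++ k′ ∷ inorder (rotateRight (Node c k tr))
      ≡⟨ cong (λ xs → inorder l ++ k′ ∷ xs) (inorder-rotateRight (Node c k tr)) ⟩
    inorder l ++ k′ ∷ inorder c ++ k ∷ inorder tr
      ≡⟨ sym (++-assoc (inorder l) (k′ ∷ inorder c) (k ∷ inorder tr)) ⟩
    (inorder l ++ k′ ∷ inorder c) ++ k ∷ inorder tr ∎
    where open ≡-Reasoning
  inorder-joinRight (Node l k′ c) k tr | false = begin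
    inorder (balanceRight l k′ (proj₁ (joinRight c k tr)))
      ≡⟨ inorder-balanceRight l k′ (proj₁ (joinRight c k tr)) ⟩
    inorder l ++ k′ ∷ inorder (proj₁ (joinRight c k tr))
      ≡⟨ cong (λ xs → inorder l ++ k′ ∷ xs) (inorder-joinRight c k tr) ⟩
    inorder l ++ k′ ∷ inorder c ++ k ∷ inorder tr
      ≡⟨ sym (++-assoc (inorder l) (k′ ∷ inorder c) (k ∷ inorder tr)) ⟩
    (inorder l ++ k′ ∷ inorder c) ++ k ∷ inorder tr ∎
    where open ≡-Reasoning

  work-joinRight : (tl : Tree A) (k : A) (tr : Tree A) →
                   proj₂ (joinRight tl k tr) ≤ suc (h tl ∸ h tr)
  work-joinRight Leaf k tr = s≤s z≤n
  work-joinRight (Node l k′ c) k tr with h c ≤ᵇ suc (h tr) | ≤ᵇ-reflects-≤ (h c) (suc (h tr))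
  ... | true | _ with h (Node c k tr) ≤ᵇ suc (h l)
  ...   | true  = s≤s z≤n
  ...   | false = s≤s z≤n
  work-joinRight (Node l k′ c) k tr | false | ofⁿ c≰ = s≤s (begin
    proj₂ (joinRight c k tr)     ≤⟨ work-joinRight c k tr ⟩
    suc (h c ∸ h tr)             ≡⟨ +-∸-assoc 1 tr≤c ⟨
    suc (h c) ∸ h tr             ≤⟨ ∸-monoˡ-≤ (h tr) (s≤s (m≤n⊔m (h l) (h c))) ⟩
    suc (h l ⊔ h c) ∸ h tr       ∎)
    where
    open ≤-Reasoning
    tr≤c : h tr ≤ h c
    tr≤c = ≤-trans (n≤1+n (h tr)) (<⇒≤ (≰⇒> c≰))

  data AVLʰ : ℕ → Tree A → Set where
    leaf      : AVLʰ 0 Leaf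
    balanced  : ∀ {n l k r} → AVLʰ n l → AVLʰ n r → AVLʰ (suc n) (Node l k r)
    leftHigh  : ∀ {n l k r} → AVLʰ (suc n) l → AVLʰ n r → AVLʰ (suc (suc n)) (Node l k r)
    rightHigh : ∀ {n l k r} → AVLʰ n l → AVLʰ (suc n) r → AVLʰ (suc (suc n)) (Node l k r)

  height-AVLʰ : ∀ {n t} → AVLʰ n t → h t ≡ n
  height-AVLʰ leaf                    = refl
  height-AVLʰ (balanced {n} pl pr)
    rewrite height-AVLʰ pl | height-AVLʰ pr = cong suc (⊔-idem n)
  height-AVLʰ (leftHigh {n} pl pr)
    rewrite height-AVLʰ pl | height-AVLʰ pr = cong suc (m≥n⇒m⊔n≡m (n≤1+n n))
  height-AVLʰ (rightHigh {n} pl pr)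
    rewrite height-AVLʰ pl | height-AVLʰ pr = cong suc (m≤n⇒m⊔n≡n (n≤1+n n))

  heights-≤ : ∀ {i j x y} → AVLʰ i x → AVLʰ j y → i ≤ suc j → h x ≤ suc (h y)
  heights-≤ px py i≤ rewrite height-AVLʰ px | height-AVLʰ py = i≤

  heights-> : ∀ {i j x y} → AVLʰ i x → AVLʰ j y → suc j < i → suc (h y) < h x
  heights-> px py j<i rewrite height-AVLʰ px | height-AVLʰ py = j<i

  AVLʰ⇒AVL : ∀ {n t} → AVLʰ n t → AVL t
  AVLʰ⇒AVL leaf = avl-leaf
  AVLʰ⇒AVL (balanced {n} {k = k} pl pr) = avl-node k (AVLʰ⇒AVL pl) (AVLʰ⇒AVL pr)
    (heights-≤ pl pr (n≤1+n n)) (heights-≤ pr pl (n≤1+n n))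
  AVLʰ⇒AVL (leftHigh {n} {k = k} pl pr) = avl-node k (AVLʰ⇒AVL pl) (AVLʰ⇒AVL pr)
    (heights-≤ pl pr ≤-refl) (heights-≤ pr pl (m≤n⇒m≤1+n (n≤1+n n)))
  AVLʰ⇒AVL (rightHigh {n} {k = k} pl pr) = avl-node k (AVLʰ⇒AVL pl) (AVLʰ⇒AVL pr)
    (heights-≤ pl pr (m≤n⇒m≤1+n (n≤1+n n))) (heights-≤ pr pl ≤-refl)

  node-AVLʰ : ∀ {a b l r} (k : A) → AVLʰ a l → AVLʰ b r → a ≤ suc b → b ≤ suc a →
              AVLʰ (suc (a ⊔ b)) (Node l k r)
  node-AVLʰ {a} {b} k pl pr a≤ b≤ with balance a≤ b≤
  ... | ∼0 rewrite ⊔-idem a = balanced pl pr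
  ... | ∼- rewrite m≥n⇒m⊔n≡m (n≤1+n b) = leftHigh pl pr
  ... | ∼+ rewrite m≤n⇒m⊔n≡n (n≤1+n a) = rightHigh pl pr

  AVL⇒AVLʰ : ∀ {t} → AVL t → AVLʰ (h t) t
  AVL⇒AVLʰ avl-leaf                  = leaf
  AVL⇒AVLʰ (avl-node k al ar l≤ r≤) = node-AVLʰ k (AVL⇒AVLʰ al) (AVL⇒AVLʰ ar) l≤ r≤

  -- The possible results of joinRight on an AVL tree of height 1 + n.  A grown result is
  -- right-high with left child of height n, the one shape the parent can repair by rotateLeft.
  data RightJoined (n : ℕ) : Tree A → Set where
    same  : ∀ {t} → AVLʰ (suc n) t → RightJoined n t
    grown : ∀ {a y b} → AVLʰ n a → AVLʰ (suc n) b → RightJoined n (Node a y b)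

  RightJoined⇒AVL : ∀ {n t} → RightJoined n t → AVL t
  RightJoined⇒AVL (same pt)             = AVLʰ⇒AVL pt
  RightJoined⇒AVL (grown {y = y} pa pb) = AVLʰ⇒AVL (rightHigh {k = y} pa pb)

  RightJoined-height : ∀ {n t} → RightJoined n t → h t ≤ suc (suc n)
  RightJoined-height (same pt) rewrite height-AVLʰ pt = n≤1+n _
  RightJoined-height (grown {y = y} pa pb)
    rewrite height-AVLʰ (rightHigh {k = y} pa pb) = ≤-refl

  balanceRight-balanced : ∀ {n l r} (k : A) → AVLʰ (suc n) l → RightJoined n r →
                          RightJoined (suc n) (balanceRight l k r)
  balanceRight-balanced k pl (same pr)
    rewrite ≤ᵇ-true (heights-≤ pr pl (n≤1+n _)) = same (balanced pl pr)
  balanceRight-balanced k pl (grown {y = y} pa pb)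
    rewrite ≤ᵇ-true (heights-≤ (rightHigh {k = y} pa pb) pl ≤-refl) = grown pl (rightHigh pa pb)

  balanceRight-leftHigh : ∀ {n l r} (k : A) → AVLʰ (suc (suc n)) l → RightJoined n r →
                          RightJoined (suc (suc n)) (balanceRight l k r)
  balanceRight-leftHigh k pl (same pr)
    rewrite ≤ᵇ-true (heights-≤ pr pl (m≤n⇒m≤1+n (n≤1+n _))) = same (leftHigh pl pr)
  balanceRight-leftHigh k pl (grown {y = y} pa pb)
    rewrite ≤ᵇ-true (heights-≤ (rightHigh {k = y} pa pb) pl (n≤1+n _))
    = same (balanced pl (rightHigh pa pb))

  balanceRight-rightHigh : ∀ {n l r} (k : A) → AVLʰ n l → RightJoined n r →
                           RightJoined (suc n) (balanceRight l k r)
  balanceRight-rightHigh k pl (same pr)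
    rewrite ≤ᵇ-true (heights-≤ pr pl ≤-refl) = same (rightHigh pl pr)
  balanceRight-rightHigh k pl (grown {y = y} pa pb)
    rewrite ≤ᵇ-false (heights-> (rightHigh {k = y} pa pb) pl ≤-refl)
    = same (balanced (balanced pl pa) pb)

  doubleRotation-AVLʰ : ∀ {n l c tr} (k′ k : A) → AVLʰ n l → AVLʰ (suc n) c → AVLʰ n tr →
                        AVLʰ (suc (suc n)) (rotateLeft (Node l k′ (rotateRight (Node c k tr))))
  doubleRotation-AVLʰ k′ k pl (balanced pa pb)  ptr = balanced (balanced pl pa) (balanced pb ptr)
  doubleRotation-AVLʰ k′ k pl (leftHigh pa pb)  ptr = balanced (balanced pl pa) (rightHigh pb ptr)
  doubleRotation-AVLʰ k′ k pl (rightHigh pa pb) ptr = balanced (leftHigh pl pa) (balanced pb ptr)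

  joinRight-AVLʰ : ∀ d {m tl tr} (k : A) → AVLʰ (suc (suc (d + m))) tl → AVLʰ m tr →
                   RightJoined (suc (d + m)) (proj₁ (joinRight tl k tr))
  joinRight-AVLʰ zero k (balanced pl pc) ptr
    rewrite ≤ᵇ-true (heights-≤ pc ptr ≤-refl)
          | ≤ᵇ-true (heights-≤ (leftHigh {k = k} pc ptr) pl ≤-refl)
    = grown pl (leftHigh pc ptr)
  joinRight-AVLʰ (suc d) k (balanced {k = k′} pl pc) ptr
    rewrite ≤ᵇ-false (heights-> pc ptr (s≤s (s≤s (m≤n+m _ d))))
    = balanceRight-balanced k′ pl (joinRight-AVLʰ d k pc ptr)
  joinRight-AVLʰ zero k (leftHigh pl pc) ptr
    rewrite ≤ᵇ-true (heights-≤ pc ptr (n≤1+n _))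
          | ≤ᵇ-true (heights-≤ (balanced {k = k} pc ptr) pl (n≤1+n _))
    = same (balanced pl (balanced pc ptr))
  -- the right child of a left-high root is two lower, so the descent also stops at d = 1
  joinRight-AVLʰ (suc zero) k (leftHigh pl pc) ptr
    rewrite ≤ᵇ-true (heights-≤ pc ptr ≤-refl)
          | ≤ᵇ-true (heights-≤ (leftHigh {k = k} pc ptr) pl (n≤1+n _))
    = same (balanced pl (leftHigh pc ptr))
  joinRight-AVLʰ (suc (suc d)) k (leftHigh {k = k′} pl pc) ptr
    rewrite ≤ᵇ-false (heights-> pc ptr (s≤s (s≤s (m≤n+m _ d))))
    = balanceRight-leftHigh k′ pl (joinRight-AVLʰ d k pc ptr)
  joinRight-AVLʰ zero k (rightHigh {k = k′} pl pc) ptr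
    rewrite ≤ᵇ-true (heights-≤ pc ptr ≤-refl)
          | ≤ᵇ-false (heights-> (leftHigh {k = k} pc ptr) pl ≤-refl)
    = same (doubleRotation-AVLʰ k′ k pl pc ptr)
  joinRight-AVLʰ (suc d) k (rightHigh {k = k′} pl pc) ptr
    rewrite ≤ᵇ-false (heights-> pc ptr (s≤s (s≤s (m≤n+m _ d))))
    = balanceRight-rightHigh k′ pl (joinRight-AVLʰ d k pc ptr)

  mirror : Tree A → Tree A
  mirror Leaf         = Leaf
  mirror (Node l k r) = Node (mirror r) k (mirror l)

  mirror-involutive : (t : Tree A) → mirror (mirror t) ≡ t
  mirror-involutive Leaf         = refl
  mirror-involutive (Node l k r) =
    cong₂ (λ l′ r′ → Node l′ k r′) (mirror-involutive l) (mirror-involutive r)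

  h-mirror : (t : Tree A) → h (mirror t) ≡ h t
  h-mirror Leaf         = refl
  h-mirror (Node l k r) =
    cong suc (trans (cong₂ _⊔_ (h-mirror r) (h-mirror l)) (⊔-comm (h r) (h l)))

  inorder-mirror : (t : Tree A) → inorder (mirror t) ≡ reverse (inorder t)
  inorder-mirror Leaf         = refl
  inorder-mirror (Node l k r) = begin
    inorder (mirror r) ++ k ∷ inorder (mirror l)
      ≡⟨ cong₂ (λ xs ys → xs ++ k ∷ ys) (inorder-mirror r) (inorder-mirror l) ⟩
    reverse (inorder r) ++ k ∷ reverse (inorder l)
      ≡⟨ sym (reverse-++-∷ (inorder l) k (inorder r)) ⟩
    reverse (inorder l ++ k ∷ inorder r) ∎
    where open ≡-Reasoning

  mirror-rotateLeft : (t : Tree A) → mirror (rotateLeft t) ≡ rotateRight (mirror t)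
  mirror-rotateLeft (Node a x (Node b y c)) = refl
  mirror-rotateLeft (Node a x Leaf)         = refl
  mirror-rotateLeft Leaf                    = refl

  mirror-rotateRight : (t : Tree A) → mirror (rotateRight t) ≡ rotateLeft (mirror t)
  mirror-rotateRight (Node (Node a x b) y c) = refl
  mirror-rotateRight (Node Leaf y c)         = refl
  mirror-rotateRight Leaf                    = refl

  mirror-balanceLeft : (l : Tree A) (k : A) (r : Tree A) →
                       mirror (balanceLeft l k r) ≡ balanceRight (mirror r) k (mirror l)
  mirror-balanceLeft l k r rewrite h-mirror l | h-mirror r with h l ≤ᵇ suc (h r)
  ... | true  = refl
  ... | false = mirror-rotateRight (Node l k r)

  mirror-joinLeft : (tl : Tree A) (k : A) (tr : Tree A) →
                    map₁ mirror (joinLeft tl k tr) ≡ joinRight (mirror tr) k (mirror tl)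
  mirror-joinLeft tl k Leaf = refl
  mirror-joinLeft tl k (Node c k′ r) rewrite h-mirror c | h-mirror tl with h c ≤ᵇ suc (h tl)
  ... | true rewrite h-mirror r | ⊔-comm (h c) (h tl) with suc (h tl ⊔ h c) ≤ᵇ suc (h r)
  ...   | true  = refl
  ...   | false = cong (_, 1) (begin
          mirror (rotateRight (Node (rotateLeft (Node tl k c)) k′ r))
            ≡⟨ mirror-rotateRight (Node (rotateLeft (Node tl k c)) k′ r) ⟩
          rotateLeft (Node (mirror r) k′ (mirror (rotateLeft (Node tl k c))))
            ≡⟨ cong (λ t → rotateLeft (Node (mirror r) k′ t)) (mirror-rotateLeft (Node tl k c)) ⟩
          rotateLeft (Node (mirror r) k′ (rotateRight (Node (mirror c) k (mirror tl)))) ∎)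
    where open ≡-Reasoning
  mirror-joinLeft tl k (Node c k′ r) | false =
    cong₂ _,_ (trans (mirror-balanceLeft (proj₁ (joinLeft tl k c)) k′ r)
                     (cong (balanceRight (mirror r) k′ ∘ proj₁) (mirror-joinLeft tl k c)))
              (cong (suc ∘ proj₂) (mirror-joinLeft tl k c))

  AVLʰ-mirror : ∀ {n t} → AVLʰ n t → AVLʰ n (mirror t)
  AVLʰ-mirror leaf              = leaf
  AVLʰ-mirror (balanced pl pr)  = balanced (AVLʰ-mirror pr) (AVLʰ-mirror pl)
  AVLʰ-mirror (leftHigh pl pr)  = rightHigh (AVLʰ-mirror pr) (AVLʰ-mirror pl)
  AVLʰ-mirror (rightHigh pl pr) = leftHigh (AVLʰ-mirror pr) (AVLʰ-mirror pl)

  AVL-mirror : ∀ {t} → AVL t → AVL (mirror t)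
  AVL-mirror = AVLʰ⇒AVL ∘ AVLʰ-mirror ∘ AVL⇒AVLʰ

  JoinSpec : Tree A → A → Tree A → Tree A × ℕ → Set
  JoinSpec tl k tr (t , w) = (inorder t ≡ inorder tl ++ k ∷ inorder tr)
                           × (w ≤ suc ∣ h tl - h tr ∣)
                           × AVL t
                           × (h t ≤ suc (h tl ⊔ h tr))

  joinRight-correct : ∀ {tl tr} (k : A) → AVL tl → AVL tr → suc (suc (h tr)) ≤ h tl →
                      JoinSpec tl k tr (joinRight tl k tr)
  joinRight-correct {tl} {tr} k al ar tl-tall =
      inorder-joinRight tl k tr
    , ≤-trans (work-joinRight tl k tr) (s≤s (m∸n≤∣m-n∣ (h tl) (h tr)))
    , RightJoined⇒AVL joined
    , (begin
        h (proj₁ (joinRight tl k tr)) ≤⟨ RightJoined-height joined ⟩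
        suc (suc (suc (d + h tr)))     ≡⟨ cong suc h-tl ⟩
        suc (h tl)                     ≤⟨ s≤s (m≤m⊔n (h tl) (h tr)) ⟩
        suc (h tl ⊔ h tr)              ∎)
    where
    open ≤-Reasoning
    d : ℕ
    d = proj₁ (m≤n⇒∃[o]m+o≡n tl-tall)
    h-tl : suc (suc (d + h tr)) ≡ h tl
    h-tl = trans (cong (suc ∘ suc) (+-comm d (h tr))) (proj₂ (m≤n⇒∃[o]m+o≡n tl-tall))
    joined : RightJoined (suc (d + h tr)) (proj₁ (joinRight tl k tr))
    joined = joinRight-AVLʰ d k (subst (λ n → AVLʰ n tl) (sym h-tl) (AVL⇒AVLʰ al)) (AVL⇒AVLʰ ar)

  JoinSpec-mirror : (tl : Tree A) (k : A) (tr : Tree A) (r : Tree A × ℕ) →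
                    JoinSpec (mirror tr) k (mirror tl) (map₁ mirror r) → JoinSpec tl k tr r
  JoinSpec-mirror tl k tr (t , w) (inorder-t , work-t , avl-t , height-t) =
      reverse-injective (begin
        reverse (inorder t)                    ≡⟨ sym (inorder-mirror t) ⟩
        inorder (mirror t)                     ≡⟨ inorder-t ⟩
        inorder (mirror (Node tl k tr))        ≡⟨ inorder-mirror (Node tl k tr) ⟩
        reverse (inorder tl ++ k ∷ inorder tr) ∎)
    , subst (λ n → w ≤ suc n)
        (trans (cong₂ ∣_-_∣ (h-mirror tr) (h-mirror tl)) (∣-∣-comm (h tr) (h tl))) work-t
    , subst AVL (mirror-involutive t) (AVL-mirror avl-t)
    , subst₂ _≤_ (h-mirror t) (h-mirror (Node tl k tr)) height-t
    where open ≡-Reasoning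

  joinLeft-correct : ∀ {tl tr} (k : A) → AVL tl → AVL tr → suc (suc (h tl)) ≤ h tr →
                     JoinSpec tl k tr (joinLeft tl k tr)
  joinLeft-correct {tl} {tr} k al ar tr-tall =
    JoinSpec-mirror tl k tr (joinLeft tl k tr)
      (subst (JoinSpec (mirror tr) k (mirror tl)) (sym (mirror-joinLeft tl k tr))
        (joinRight-correct k (AVL-mirror ar) (AVL-mirror al)
          (subst₂ (λ a b → suc (suc a) ≤ b) (sym (h-mirror tl)) (sym (h-mirror tr)) tr-tall)))

  join-correct : ∀ {tl tr} (k : A) → AVL tl → AVL tr → JoinSpec tl k tr (join tl k tr)
  join-correct {tl} {tr} k al ar with suc (h tr) <ᵇ h tl | <ᵇ-reflects-< (suc (h tr)) (h tl)
  ... | true  | ofʸ tl-tall = joinRight-correct k al ar tl-tall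
  ... | false | ofⁿ tl-short with suc (h tl) <ᵇ h tr | <ᵇ-reflects-< (suc (h tl)) (h tr)
  ...   | true  | ofʸ tr-tall  = joinLeft-correct k al ar tr-tall
  ...   | false | ofⁿ tr-short =
    refl , s≤s z≤n , avl-node k al ar (≮⇒≥ tl-short) (≮⇒≥ tr-short) , ≤-refl

lemma1 : Σ ℕ λ c → ∀ {A : Set} (Tl : Tree A) (k : A) (Tr : Tree A) → AVL Tl → AVL Tr →
           (inorder (proj₁ (join Tl k Tr)) ≡ inorder Tl ++ k ∷ inorder Tr)
           × (proj₂ (join Tl k Tr) ≤ c * suc ∣ h Tl - h Tr ∣)
           × AVL (proj₁ (join Tl k Tr))
           × (h (proj₁ (join Tl k Tr)) ≤ suc (h Tl ⊔ h Tr))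
lemma1 = 1 , λ Tl k Tr al ar →
  let inorder-ok , work-ok , avl-ok , height-ok = join-correct k al ar
  in inorder-ok , ≤-trans work-ok (≤-reflexive (sym (*-identityˡ _))) , avl-ok , height-ok
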